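{- Let $\{J(n)\}_{n\ge0}$ be any sequence of complex numbers, and define the sequence $\{\widehat{J}(n)\}$ by $$\widehat{J}(n)=\sum_{p=0}^n(-1)^p\binom{ -\frac12}{p}^{2}\binom np\left(\sum_{i=0}^{p-1}\frac{ -1}{(2i+1)^2}\binom{ -\frac12}{i}^{ -2}\sum_{j=0}^i(-1)^j\binom ij J(j+1)\right)\quad(n\ge 0),$$ and $\widehat{J}(n)=0$ for $n<0$. Then for all $n\ge1$, $$4n^2\widehat{J}(n)-(8n^2-8n+3)\widehat{J}(n-1)+4(n-1)^2\widehat{J}(n-2)=J(n).$$
   Context: $\binom{ -1/2}{p}=\frac{(-1/2)(-1/2-1)\cdots(-1/2-p+1)}{p!}$ is the generalized binomial coefficient. -}

module Defs where

open import Level using (Level)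
open import Data.Nat as ℕ using (ℕ; zero; suc)
open import Data.Integer as ℤ using (ℤ; +_; -[1+_])
open import Data.Rational as ℚ using (ℚ; 0ℚ; 1ℚ; _/_; 1/_; ≢-nonZero)
open import Data.Rational.Properties using (+-*-ring; _≟_)
open import Algebra.Module.Bundles using (LeftModule)
open import Relation.Nullary using (yes; no)
open import Data.Nat.Combinatorics using (_C_)

ℕ→ℚ : ℕ → ℚ
ℕ→ℚ n = + n / 1

-- total inverse on ℚ (1/q for q ≠ 0, and 0 at 0); only ever applied to
-- nonzero arguments below
inv : ℚ → ℚ
inv q with q ≟ 0ℚ
... | yes _ = 0ℚ
... | no q≢0 = 1/_ q {{≢-nonZero q≢0}}

falling : ℚ → ℕ → ℚ
falling a zero = 1ℚ
falling a (suc p) = falling a p ℚ.* (a ℚ.- ℕ→ℚ p)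

genBinom : ℚ → ℕ → ℚ
genBinom a p = falling a p ℚ.* inv (ℕ→ℚ (p ℕ.!))

-½ : ℚ
-½ = -[1+ 0 ] / 2

sgn : ℕ → ℚ
sgn zero = 1ℚ
sgn (suc p) = ℚ.- sgn p

binomℚ : ℕ → ℕ → ℚ
binomℚ n k = ℕ→ℚ (n C k)

module _ {m ℓ : Level} (M : LeftModule +-*-ring m ℓ) where
  open LeftModule M

  sumBelow : ℕ → (ℕ → Carrierᴹ) → Carrierᴹ
  sumBelow zero f = 0ᴹ
  sumBelow (suc n) f = sumBelow n f +ᴹ f n

  innerSum : (ℕ → Carrierᴹ) → ℕ → Carrierᴹ
  innerSum J i = sumBelow (suc i) (λ j → (sgn j ℚ.* binomℚ i j) *ₗ J (suc j))

  middleSum : (ℕ → Carrierᴹ) → ℕ → Carrierᴹ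
  middleSum J p = sumBelow p (λ i →
    ((ℚ.- 1ℚ) ℚ.* inv (ℕ→ℚ ((2 ℕ.* i ℕ.+ 1) ℕ.* (2 ℕ.* i ℕ.+ 1)))
      ℚ.* inv (genBinom -½ i ℚ.* genBinom -½ i)) *ₗ innerSum J i)

  Jhat : (ℕ → Carrierᴹ) → ℕ → Carrierᴹ
  Jhat J n = sumBelow (suc n) (λ p →
    (sgn p ℚ.* (genBinom -½ p ℚ.* genBinom -½ p) ℚ.* binomℚ n p) *ₗ middleSum J p)

  JhatZ : (ℕ → Carrierᴹ) → ℤ → Carrierᴹ
  JhatZ J (+ n) = Jhat J n
  JhatZ J -[1+ _ ] = 0ᴹ

{-# OPTIONS --safe #-}

-- Ĵ(n) = Σ_p C(n,p) x_p is the binomial transform of x_p = (-1)^p binom(-1/2,p)² M_p, where M_p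
-- is the middle sum. The binomial transform turns multiplication by the index into shifts, so the
-- three-term operator of the theorem, applied to Ĵ, is the binomial transform of the first-order
-- expression 4(p+1)² x_{p+1} + (2p+1)² x_p. Since 2(p+1) binom(-1/2,p+1) = -(2p+1) binom(-1/2,p),
-- that expression equals (-1)^p (2p+1)² binom(-1/2,p)² (M_p - M_{p+1}) = (-1)^p S_p, where S_p is
-- the inner sum. Binomial inversion, Σ_p C(m,p) (-1)^p Σ_j C(p,j) z_j = (-1)^m z_m, applied to
-- z_j = (-1)^j J(j+1), turns this into J(m+1).

module Submission where

open import Defs
open import Level using (Level)
open import Function.Base using (_∘_)
open import Data.Empty using (⊥-elim)
open import Data.List.Base using ([]; _∷_)
open import Data.Nat as ℕ using (ℕ; zero; suc; pred; _!; _≤_)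
import Data.Nat.Properties as ℕ
import Data.Nat.Coprimality as Coprime
open import Data.Nat.Combinatorics using (_C_; nCk+nC[k+1]≡[n+1]C[k+1])
open import Data.Nat.Combinatorics.Specification using (k>n⇒nCk≡0)
import Data.Nat.Tactic.RingSolver as ℕ-Solver
open import Data.Integer as ℤ using (+_)
import Data.Integer.Properties as ℤ
open import Data.Rational as ℚ using (0ℚ; 1ℚ; mkℚ; toℚᵘ)
open import Data.Rational.Properties as ℚ using (+-*-ring; +-*-commutativeRing; _≟_)
import Data.Rational.Unnormalised as ℚᵘ
import Data.Rational.Unnormalised.Properties as ℚᵘ
open import Algebra.Bundles using (CommutativeRing; CommutativeMonoid)
open import Algebra.Module.Bundles using (LeftModule)
import Algebra.Properties.CommutativeSemigroup as CommutativeSemigroupProperties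
open import Algebra.Properties.Ring +-*-ring using (-1*x≈-x)
open import Relation.Nullary using (yes; no)
open import Relation.Nullary.Decidable.Core using (dec⇒maybe)
open import Relation.Binary.PropositionalEquality as ≡
  using (_≡_; _≢_; refl; sym; trans; cong; cong₂; module ≡-Reasoning)
open import Tactic.RingSolver using (solve; solve-∀)
open import Tactic.RingSolver.Core.AlmostCommutativeRing using (AlmostCommutativeRing; fromCommutativeRing)

ℚ-ring : AlmostCommutativeRing _ _
ℚ-ring = fromCommutativeRing +-*-commutativeRing (λ q → dec⇒maybe (0ℚ ≟ q))

ℕ→ℚ≡mkℚ : ∀ n → ℕ→ℚ n ≡ mkℚ (+ n) 0 (Coprime.sym (Coprime.1-coprimeTo n))
ℕ→ℚ≡mkℚ n = ℚ.normalize-coprime (Coprime.sym (Coprime.1-coprimeTo n))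

ℕ→ℚ-suc : ∀ n → ℕ→ℚ (suc n) ≡ 1ℚ ℚ.+ ℕ→ℚ n
ℕ→ℚ-suc n = ℚ.toℚᵘ-injective (begin
  toℚᵘ (ℕ→ℚ (suc n))                    ≡⟨ cong toℚᵘ (ℕ→ℚ≡mkℚ (suc n)) ⟩
  ℚᵘ.mkℚᵘ (+ suc n) 0                   ≈⟨ ℚᵘ.*≡* (cong (ℤ._* + 1) (sym 1+n≡1*1+n*1)) ⟩
  ℚᵘ.mkℚᵘ (+ 1) 0 ℚᵘ.+ ℚᵘ.mkℚᵘ (+ n) 0  ≡⟨ cong (toℚᵘ 1ℚ ℚᵘ.+_) (cong toℚᵘ (sym (ℕ→ℚ≡mkℚ n))) ⟩
  toℚᵘ 1ℚ ℚᵘ.+ toℚᵘ (ℕ→ℚ n)             ≈⟨ ℚᵘ.≃-sym (ℚ.toℚᵘ-homo-+ 1ℚ (ℕ→ℚ n)) ⟩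
  toℚᵘ (1ℚ ℚ.+ ℕ→ℚ n)                   ∎)
  where
  open ℚᵘ.≃-Reasoning
  1+n≡1*1+n*1 : + 1 ℤ.* + 1 ℤ.+ + n ℤ.* + 1 ≡ + suc n
  1+n≡1*1+n*1 = cong₂ ℤ._+_ (ℤ.*-identityʳ (+ 1)) (ℤ.*-identityʳ (+ n))

ℕ→ℚ-+ : ∀ m n → ℕ→ℚ (m ℕ.+ n) ≡ ℕ→ℚ m ℚ.+ ℕ→ℚ n
ℕ→ℚ-+ zero n = sym (ℚ.+-identityˡ (ℕ→ℚ n))
ℕ→ℚ-+ (suc m) n = begin
  ℕ→ℚ (suc (m ℕ.+ n))         ≡⟨ ℕ→ℚ-suc (m ℕ.+ n) ⟩
  1ℚ ℚ.+ ℕ→ℚ (m ℕ.+ n)        ≡⟨ cong (1ℚ ℚ.+_) (ℕ→ℚ-+ m n) ⟩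
  1ℚ ℚ.+ (ℕ→ℚ m ℚ.+ ℕ→ℚ n)    ≡⟨ ℚ.+-assoc 1ℚ (ℕ→ℚ m) (ℕ→ℚ n) ⟨
  1ℚ ℚ.+ ℕ→ℚ m ℚ.+ ℕ→ℚ n      ≡⟨ cong (ℚ._+ ℕ→ℚ n) (ℕ→ℚ-suc m) ⟨
  ℕ→ℚ (suc m) ℚ.+ ℕ→ℚ n       ∎
  where open ≡-Reasoning

ℕ→ℚ-* : ∀ m n → ℕ→ℚ (m ℕ.* n) ≡ ℕ→ℚ m ℚ.* ℕ→ℚ n
ℕ→ℚ-* zero n = sym (ℚ.*-zeroˡ (ℕ→ℚ n))
ℕ→ℚ-* (suc m) n = begin
  ℕ→ℚ (n ℕ.+ m ℕ.* n)                ≡⟨ ℕ→ℚ-+ n (m ℕ.* n) ⟩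
  ℕ→ℚ n ℚ.+ ℕ→ℚ (m ℕ.* n)            ≡⟨ cong (ℕ→ℚ n ℚ.+_) (ℕ→ℚ-* m n) ⟩
  ℕ→ℚ n ℚ.+ ℕ→ℚ m ℚ.* ℕ→ℚ n          ≡⟨ cong (ℚ._+ ℕ→ℚ m ℚ.* ℕ→ℚ n) (ℚ.*-identityˡ (ℕ→ℚ n)) ⟨
  1ℚ ℚ.* ℕ→ℚ n ℚ.+ ℕ→ℚ m ℚ.* ℕ→ℚ n   ≡⟨ ℚ.*-distribʳ-+ (ℕ→ℚ n) 1ℚ (ℕ→ℚ m) ⟨
  (1ℚ ℚ.+ ℕ→ℚ m) ℚ.* ℕ→ℚ n           ≡⟨ cong (ℚ._* ℕ→ℚ n) (ℕ→ℚ-suc m) ⟨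
  ℕ→ℚ (suc m) ℚ.* ℕ→ℚ n              ∎
  where open ≡-Reasoning

ℕ→ℚ-odd : ∀ p → ℕ→ℚ (2 ℕ.* p ℕ.+ 1) ≡ ℕ→ℚ 2 ℚ.* ℕ→ℚ p ℚ.+ 1ℚ
ℕ→ℚ-odd p = trans (ℕ→ℚ-+ (2 ℕ.* p) 1) (cong (ℚ._+ 1ℚ) (ℕ→ℚ-* 2 p))

ℕ→ℚ-≢0 : ∀ {n} → n ≢ 0 → ℕ→ℚ n ≢ 0ℚ
ℕ→ℚ-≢0 {zero} n≢0 _ = n≢0 refl
ℕ→ℚ-≢0 {suc n} _ eq with trans (sym (ℕ→ℚ≡mkℚ (suc n))) eq
... | ()

ℕ→ℚ-!-≢0 : ∀ p → ℕ→ℚ (p !) ≢ 0ℚ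
ℕ→ℚ-!-≢0 p = ℕ→ℚ-≢0 (ℕ.≢-nonZero⁻¹ (p !) {{p ℕ.!≢0}})

ℕ→ℚ-odd-≢0 : ∀ p → ℕ→ℚ (2 ℕ.* p ℕ.+ 1) ≢ 0ℚ
ℕ→ℚ-odd-≢0 p = ℕ→ℚ-≢0 (ℕ.m+1+n≢0 (2 ℕ.* p))

*-inverse : ∀ {q} → q ≢ 0ℚ → q ℚ.* inv q ≡ 1ℚ
*-inverse {q} q≢0 with q ≟ 0ℚ
... | yes q≡0 = ⊥-elim (q≢0 q≡0)
... | no q≢0′ = ℚ.*-inverseʳ q {{ℚ.≢-nonZero q≢0′}}

*-cancelʳ : ∀ {x y z} → z ≢ 0ℚ → x ℚ.* z ≡ y ℚ.* z → x ≡ y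
*-cancelʳ {x} {y} {z} z≢0 eq = begin
  x                      ≡⟨ cancel x ⟨
  x ℚ.* z ℚ.* inv z      ≡⟨ cong (ℚ._* inv z) eq ⟩
  y ℚ.* z ℚ.* inv z      ≡⟨ cancel y ⟩
  y                      ∎
  where
  open ≡-Reasoning
  cancel : ∀ w → w ℚ.* z ℚ.* inv z ≡ w
  cancel w = trans (ℚ.*-assoc w z (inv z)) (trans (cong (w ℚ.*_) (*-inverse z≢0)) (ℚ.*-identityʳ w))

*-≢0 : ∀ {x y} → x ≢ 0ℚ → y ≢ 0ℚ → x ℚ.* y ≢ 0ℚ
*-≢0 {x} {y} x≢0 y≢0 xy≡0 = x≢0 (*-cancelʳ y≢0 (trans xy≡0 (sym (ℚ.*-zeroˡ y))))

sgn-square : ∀ p → sgn p ℚ.* sgn p ≡ 1ℚ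
sgn-square zero    = refl
sgn-square (suc p) = trans (neg-square (sgn p)) (sgn-square p)
  where
  neg-square : ∀ s → ℚ.- s ℚ.* ℚ.- s ≡ s ℚ.* s
  neg-square = solve-∀ ℚ-ring

recurrence-coefficients : ∀ m →
  ℕ→ℚ (4 ℕ.* suc m ℕ.* suc m) ℚ.+ ℚ.- ℕ→ℚ (8 ℕ.* suc m ℕ.* suc m ℕ.∸ 8 ℕ.* suc m ℕ.+ 3)
    ℚ.+ ℕ→ℚ (4 ℕ.* m ℕ.* m) ≡ 1ℚ
recurrence-coefficients m = rearrange (ℕ→ℚ a) (ℕ→ℚ b) (ℕ→ℚ c) (begin
  ℕ→ℚ a ℚ.+ ℕ→ℚ c        ≡⟨ ℕ→ℚ-+ a c ⟨
  ℕ→ℚ (a ℕ.+ c)          ≡⟨ cong ℕ→ℚ a+c≡b+1 ⟩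
  ℕ→ℚ (b ℕ.+ 1)          ≡⟨ ℕ→ℚ-+ b 1 ⟩
  ℕ→ℚ b ℚ.+ 1ℚ           ∎)
  where
  open ≡-Reasoning
  a = 4 ℕ.* suc m ℕ.* suc m
  b = 8 ℕ.* suc m ℕ.* suc m ℕ.∸ 8 ℕ.* suc m ℕ.+ 3
  c = 4 ℕ.* m ℕ.* m
  expand : 8 ℕ.* suc m ℕ.* m ℕ.+ 8 ℕ.* suc m ≡ 8 ℕ.* suc m ℕ.* suc m
  expand = ℕ-Solver.solve (m ∷ [])
  a+c≡b+1 : a ℕ.+ c ≡ b ℕ.+ 1
  a+c≡b+1 = begin
    4 ℕ.* suc m ℕ.* suc m ℕ.+ 4 ℕ.* m ℕ.* m
      ≡⟨ ℕ-Solver.solve (m ∷ []) ⟩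
    8 ℕ.* suc m ℕ.* m ℕ.+ 3 ℕ.+ 1
      ≡⟨ cong (λ k → k ℕ.+ 3 ℕ.+ 1) (ℕ.m+n∸n≡m (8 ℕ.* suc m ℕ.* m) (8 ℕ.* suc m)) ⟨
    8 ℕ.* suc m ℕ.* m ℕ.+ 8 ℕ.* suc m ℕ.∸ 8 ℕ.* suc m ℕ.+ 3 ℕ.+ 1
      ≡⟨ cong (λ k → k ℕ.∸ 8 ℕ.* suc m ℕ.+ 3 ℕ.+ 1) expand ⟩
    8 ℕ.* suc m ℕ.* suc m ℕ.∸ 8 ℕ.* suc m ℕ.+ 3 ℕ.+ 1
      ∎
  rearrange : ∀ x y z → x ℚ.+ z ≡ y ℚ.+ 1ℚ → x ℚ.+ ℚ.- y ℚ.+ z ≡ 1ℚ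
  rearrange x y z x+z≡y+1 = begin
    x ℚ.+ ℚ.- y ℚ.+ z      ≡⟨ solve (x ∷ y ∷ z ∷ []) ℚ-ring ⟩
    x ℚ.+ z ℚ.+ ℚ.- y      ≡⟨ cong (ℚ._+ ℚ.- y) x+z≡y+1 ⟩
    y ℚ.+ 1ℚ ℚ.+ ℚ.- y     ≡⟨ solve (y ∷ []) ℚ-ring ⟩
    1ℚ                     ∎

genBinom-*-! : ∀ a p → genBinom a p ℚ.* ℕ→ℚ (p !) ≡ falling a p
genBinom-*-! a p = begin
  falling a p ℚ.* inv F ℚ.* F      ≡⟨ ℚ.*-assoc (falling a p) (inv F) F ⟩
  falling a p ℚ.* (inv F ℚ.* F)    ≡⟨ cong (falling a p ℚ.*_) (trans (ℚ.*-comm (inv F) F) (*-inverse (ℕ→ℚ-!-≢0 p))) ⟩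
  falling a p ℚ.* 1ℚ               ≡⟨ ℚ.*-identityʳ (falling a p) ⟩
  falling a p                      ∎
  where
  open ≡-Reasoning
  F = ℕ→ℚ (p !)

genBinom-suc : ∀ a p → ℕ→ℚ (suc p) ℚ.* genBinom a (suc p) ≡ (a ℚ.- ℕ→ℚ p) ℚ.* genBinom a p
genBinom-suc a p = *-cancelʳ (ℕ→ℚ-!-≢0 p) (begin
  ℕ→ℚ (suc p) ℚ.* genBinom a (suc p) ℚ.* ℕ→ℚ (p !)  ≡⟨ xy∙z≈y∙xz (ℕ→ℚ (suc p)) (genBinom a (suc p)) (ℕ→ℚ (p !)) ⟩
  genBinom a (suc p) ℚ.* (ℕ→ℚ (suc p) ℚ.* ℕ→ℚ (p !)) ≡⟨ cong (genBinom a (suc p) ℚ.*_) (ℕ→ℚ-* (suc p) (p !)) ⟨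
  genBinom a (suc p) ℚ.* ℕ→ℚ (suc p !)              ≡⟨ genBinom-*-! a (suc p) ⟩
  falling a p ℚ.* (a ℚ.- ℕ→ℚ p)                     ≡⟨ cong (ℚ._* (a ℚ.- ℕ→ℚ p)) (genBinom-*-! a p) ⟨
  genBinom a p ℚ.* ℕ→ℚ (p !) ℚ.* (a ℚ.- ℕ→ℚ p)      ≡⟨ xy∙z≈zx∙y (genBinom a p) (ℕ→ℚ (p !)) (a ℚ.- ℕ→ℚ p) ⟩
  (a ℚ.- ℕ→ℚ p) ℚ.* genBinom a p ℚ.* ℕ→ℚ (p !)      ∎)
  where
  open ≡-Reasoning
  open CommutativeSemigroupProperties (CommutativeRing.*-commutativeSemigroup +-*-commutativeRing)
    using (xy∙z≈y∙xz; xy∙z≈zx∙y)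

genBinom-½-suc : ∀ p →
  ℕ→ℚ 2 ℚ.* ℕ→ℚ (suc p) ℚ.* genBinom -½ (suc p) ≡ ℚ.- (ℕ→ℚ (2 ℕ.* p ℕ.+ 1) ℚ.* genBinom -½ p)
genBinom-½-suc p = begin
  ℕ→ℚ 2 ℚ.* ℕ→ℚ (suc p) ℚ.* genBinom -½ (suc p)   ≡⟨ ℚ.*-assoc (ℕ→ℚ 2) (ℕ→ℚ (suc p)) (genBinom -½ (suc p)) ⟩
  ℕ→ℚ 2 ℚ.* (ℕ→ℚ (suc p) ℚ.* genBinom -½ (suc p)) ≡⟨ cong (ℕ→ℚ 2 ℚ.*_) (genBinom-suc -½ p) ⟩
  ℕ→ℚ 2 ℚ.* ((-½ ℚ.- ℕ→ℚ p) ℚ.* genBinom -½ p)    ≡⟨ double-½ (ℕ→ℚ p) (genBinom -½ p) ⟩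
  ℚ.- ((ℕ→ℚ 2 ℚ.* ℕ→ℚ p ℚ.+ 1ℚ) ℚ.* genBinom -½ p) ≡⟨ cong (λ t → ℚ.- (t ℚ.* genBinom -½ p)) (ℕ→ℚ-odd p) ⟨
  ℚ.- (ℕ→ℚ (2 ℕ.* p ℕ.+ 1) ℚ.* genBinom -½ p)     ∎
  where
  open ≡-Reasoning
  double-½ : ∀ n b → ℕ→ℚ 2 ℚ.* ((-½ ℚ.- n) ℚ.* b) ≡ ℚ.- ((ℕ→ℚ 2 ℚ.* n ℚ.+ 1ℚ) ℚ.* b)
  double-½ = solve-∀ ℚ-ring

genBinom-½-≢0 : ∀ p → genBinom -½ p ≢ 0ℚ
genBinom-½-≢0 zero = ℚ.1≢0
genBinom-½-≢0 (suc p) β≡0 = *-≢0 (ℕ→ℚ-odd-≢0 p) (genBinom-½-≢0 p) (ℚ.neg-injective (begin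
  ℚ.- (ℕ→ℚ (2 ℕ.* p ℕ.+ 1) ℚ.* genBinom -½ p)     ≡⟨ genBinom-½-suc p ⟨
  ℕ→ℚ 2 ℚ.* ℕ→ℚ (suc p) ℚ.* genBinom -½ (suc p)   ≡⟨ cong (ℕ→ℚ 2 ℚ.* ℕ→ℚ (suc p) ℚ.*_) β≡0 ⟩
  ℕ→ℚ 2 ℚ.* ℕ→ℚ (suc p) ℚ.* 0ℚ                    ≡⟨ ℚ.*-zeroʳ (ℕ→ℚ 2 ℚ.* ℕ→ℚ (suc p)) ⟩
  ℚ.- 0ℚ                                          ∎))
  where open ≡-Reasoning

genBinom-½²-suc : ∀ p →
  ℕ→ℚ (4 ℕ.* suc p ℕ.* suc p) ℚ.* (genBinom -½ (suc p) ℚ.* genBinom -½ (suc p))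
    ≡ ℕ→ℚ ((2 ℕ.* p ℕ.+ 1) ℕ.* (2 ℕ.* p ℕ.+ 1)) ℚ.* (genBinom -½ p ℚ.* genBinom -½ p)
genBinom-½²-suc p = begin
  ℕ→ℚ (4 ℕ.* suc p ℕ.* suc p) ℚ.* (β′ ℚ.* β′)
    ≡⟨ cong (ℚ._* (β′ ℚ.* β′)) (trans (ℕ→ℚ-* (4 ℕ.* suc p) (suc p)) (cong (ℚ._* N) (ℕ→ℚ-* 4 (suc p)))) ⟩
  ℕ→ℚ 4 ℚ.* N ℚ.* N ℚ.* (β′ ℚ.* β′)
    ≡⟨ square-double N β′ ⟩
  (ℕ→ℚ 2 ℚ.* N ℚ.* β′) ℚ.* (ℕ→ℚ 2 ℚ.* N ℚ.* β′)
    ≡⟨ cong₂ ℚ._*_ (genBinom-½-suc p) (genBinom-½-suc p) ⟩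
  ℚ.- (T ℚ.* β) ℚ.* ℚ.- (T ℚ.* β)
    ≡⟨ neg-square T β ⟩
  T ℚ.* T ℚ.* (β ℚ.* β)
    ≡⟨ cong (ℚ._* (β ℚ.* β)) (ℕ→ℚ-* (2 ℕ.* p ℕ.+ 1) (2 ℕ.* p ℕ.+ 1)) ⟨
  ℕ→ℚ ((2 ℕ.* p ℕ.+ 1) ℕ.* (2 ℕ.* p ℕ.+ 1)) ℚ.* (β ℚ.* β) ∎
  where
  open ≡-Reasoning
  N = ℕ→ℚ (suc p)
  T = ℕ→ℚ (2 ℕ.* p ℕ.+ 1)
  β = genBinom -½ p
  β′ = genBinom -½ (suc p)
  square-double : ∀ n b → ℕ→ℚ 4 ℚ.* n ℚ.* n ℚ.* (b ℚ.* b) ≡ (ℕ→ℚ 2 ℚ.* n ℚ.* b) ℚ.* (ℕ→ℚ 2 ℚ.* n ℚ.* b)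
  square-double = solve-∀ ℚ-ring
  neg-square : ∀ t b → ℚ.- (t ℚ.* b) ℚ.* ℚ.- (t ℚ.* b) ≡ t ℚ.* t ℚ.* (b ℚ.* b)
  neg-square = solve-∀ ℚ-ring

middleSum-coefficient : ∀ p →
  ((ℚ.- 1ℚ) ℚ.* inv (ℕ→ℚ ((2 ℕ.* p ℕ.+ 1) ℕ.* (2 ℕ.* p ℕ.+ 1)))
     ℚ.* inv (genBinom -½ p ℚ.* genBinom -½ p))
  ℚ.* (ℕ→ℚ ((2 ℕ.* p ℕ.+ 1) ℕ.* (2 ℕ.* p ℕ.+ 1)) ℚ.* (genBinom -½ p ℚ.* genBinom -½ p))
    ≡ ℚ.- 1ℚ
middleSum-coefficient p = begin
  ((ℚ.- 1ℚ) ℚ.* inv Q ℚ.* inv A) ℚ.* (Q ℚ.* A)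
    ≡⟨ regroup Q (inv Q) A (inv A) ⟩
  ℚ.- 1ℚ ℚ.* ((Q ℚ.* inv Q) ℚ.* (A ℚ.* inv A))
    ≡⟨ cong₂ (λ u v → ℚ.- 1ℚ ℚ.* (u ℚ.* v)) (*-inverse Q≢0) (*-inverse A≢0) ⟩
  ℚ.- 1ℚ ℚ.* (1ℚ ℚ.* 1ℚ)
    ≡⟨⟩
  ℚ.- 1ℚ ∎
  where
  open ≡-Reasoning
  Q = ℕ→ℚ ((2 ℕ.* p ℕ.+ 1) ℕ.* (2 ℕ.* p ℕ.+ 1))
  A = genBinom -½ p ℚ.* genBinom -½ p
  Q≢0 : Q ≢ 0ℚ
  Q≢0 rewrite ℕ→ℚ-* (2 ℕ.* p ℕ.+ 1) (2 ℕ.* p ℕ.+ 1) = *-≢0 (ℕ→ℚ-odd-≢0 p) (ℕ→ℚ-odd-≢0 p)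
  A≢0 : A ≢ 0ℚ
  A≢0 = *-≢0 (genBinom-½-≢0 p) (genBinom-½-≢0 p)
  regroup : ∀ q q′ a a′ → ((ℚ.- 1ℚ) ℚ.* q′ ℚ.* a′) ℚ.* (q ℚ.* a) ≡ ℚ.- 1ℚ ℚ.* ((q ℚ.* q′) ℚ.* (a ℚ.* a′))
  regroup = solve-∀ ℚ-ring

module _ {c ℓ : Level} (M : LeftModule +-*-ring c ℓ) where
  open LeftModule M
  open import Relation.Binary.Reasoning.Setoid ≈ᴹ-setoid
  open CommutativeSemigroupProperties (CommutativeMonoid.commutativeSemigroup +ᴹ-commutativeMonoid)
    using (interchange; x∙yz≈y∙xz; xy∙z≈xz∙y; xy∙z≈zx∙y)

  *ₗ-swap : ∀ α β v → (α ℚ.* β) *ₗ v ≈ᴹ β *ₗ (α *ₗ v)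
  *ₗ-swap α β v = ≈ᴹ-trans (*ₗ-congʳ (ℚ.*-comm α β)) (*ₗ-assoc β α v)

  ℕ→ℚ-suc-*ₗ : ∀ n v → ℕ→ℚ (suc n) *ₗ v ≈ᴹ v +ᴹ ℕ→ℚ n *ₗ v
  ℕ→ℚ-suc-*ₗ n v = begin
    ℕ→ℚ (suc n) *ₗ v          ≡⟨ ≡.cong (_*ₗ v) (ℕ→ℚ-suc n) ⟩
    (1ℚ ℚ.+ ℕ→ℚ n) *ₗ v       ≈⟨ *ₗ-distribʳ v 1ℚ (ℕ→ℚ n) ⟩
    1ℚ *ₗ v +ᴹ ℕ→ℚ n *ₗ v     ≈⟨ +ᴹ-congʳ (*ₗ-identityˡ v) ⟩
    v +ᴹ ℕ→ℚ n *ₗ v           ∎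

  ℕ→ℚ-*-*ₗ : ∀ a b v → ℕ→ℚ (a ℕ.* b) *ₗ v ≈ᴹ ℕ→ℚ a *ₗ (ℕ→ℚ b *ₗ v)
  ℕ→ℚ-*-*ₗ a b v = ≈ᴹ-trans (≈ᴹ-reflexive (≡.cong (_*ₗ v) (ℕ→ℚ-* a b))) (*ₗ-assoc (ℕ→ℚ a) (ℕ→ℚ b) v)

  ℕ→ℚ-*-*-*ₗ : ∀ a b c v → ℕ→ℚ (a ℕ.* b ℕ.* c) *ₗ v ≈ᴹ ℕ→ℚ a *ₗ (ℕ→ℚ b *ₗ (ℕ→ℚ c *ₗ v))
  ℕ→ℚ-*-*-*ₗ a b c v = ≈ᴹ-trans (ℕ→ℚ-*-*ₗ (a ℕ.* b) c v) (ℕ→ℚ-*-*ₗ a b (ℕ→ℚ c *ₗ v))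

  *ₗ-neg-cancelˡ : ∀ α u v → α *ₗ u +ᴹ (ℚ.- α) *ₗ (u +ᴹ v) ≈ᴹ (ℚ.- α) *ₗ v
  *ₗ-neg-cancelˡ α u v = begin
    α *ₗ u +ᴹ (ℚ.- α) *ₗ (u +ᴹ v)                ≈⟨ +ᴹ-congˡ (*ₗ-distribˡ (ℚ.- α) u v) ⟩
    α *ₗ u +ᴹ ((ℚ.- α) *ₗ u +ᴹ (ℚ.- α) *ₗ v)     ≈⟨ +ᴹ-assoc (α *ₗ u) _ _ ⟨
    α *ₗ u +ᴹ (ℚ.- α) *ₗ u +ᴹ (ℚ.- α) *ₗ v       ≈⟨ +ᴹ-congʳ (*ₗ-distribʳ u α (ℚ.- α)) ⟨
    (α ℚ.+ ℚ.- α) *ₗ u +ᴹ (ℚ.- α) *ₗ v           ≡⟨ ≡.cong (λ β → β *ₗ u +ᴹ (ℚ.- α) *ₗ v) (ℚ.+-inverseʳ α) ⟩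
    0ℚ *ₗ u +ᴹ (ℚ.- α) *ₗ v                      ≈⟨ +ᴹ-congʳ (*ₗ-zeroˡ u) ⟩
    0ᴹ +ᴹ (ℚ.- α) *ₗ v                           ≈⟨ +ᴹ-identityˡ _ ⟩
    (ℚ.- α) *ₗ v                                 ∎

  sumBelow-cong : ∀ n {f g : ℕ → Carrierᴹ} → (∀ p → f p ≈ᴹ g p) → sumBelow M n f ≈ᴹ sumBelow M n g
  sumBelow-cong zero    f≈g = ≈ᴹ-refl
  sumBelow-cong (suc n) f≈g = +ᴹ-cong (sumBelow-cong n f≈g) (f≈g n)

  sumBelow-+ᴹ : ∀ n (f g : ℕ → Carrierᴹ) →
                sumBelow M n (λ p → f p +ᴹ g p) ≈ᴹ sumBelow M n f +ᴹ sumBelow M n g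
  sumBelow-+ᴹ zero    f g = ≈ᴹ-sym (+ᴹ-identityˡ 0ᴹ)
  sumBelow-+ᴹ (suc n) f g = ≈ᴹ-trans (+ᴹ-congʳ (sumBelow-+ᴹ n f g)) (interchange _ _ _ _)

  sumBelow-suc-head : ∀ n (f : ℕ → Carrierᴹ) → sumBelow M (suc n) f ≈ᴹ f 0 +ᴹ sumBelow M n (f ∘ suc)
  sumBelow-suc-head zero    f = ≈ᴹ-trans (+ᴹ-identityˡ (f 0)) (≈ᴹ-sym (+ᴹ-identityʳ (f 0)))
  sumBelow-suc-head (suc n) f = ≈ᴹ-trans (+ᴹ-congʳ (sumBelow-suc-head n f)) (+ᴹ-assoc _ _ _)

  binomialTransform : (ℕ → Carrierᴹ) → ℕ → Carrierᴹ
  binomialTransform x zero    = x 0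
  binomialTransform x (suc n) = binomialTransform x n +ᴹ binomialTransform (x ∘ suc) n

  binomialSum : (ℕ → Carrierᴹ) → ℕ → Carrierᴹ
  binomialSum x n = sumBelow M (suc n) (λ p → binomℚ n p *ₗ x p)

  binomialSum-suc : ∀ x n → binomialSum x (suc n) ≈ᴹ binomialSum x n +ᴹ binomialSum (x ∘ suc) n
  binomialSum-suc x n = begin
    binomialSum x (suc n)
      ≈⟨ sumBelow-suc-head (suc n) (λ p → binomℚ (suc n) p *ₗ x p) ⟩
    x₀ +ᴹ sumBelow M (suc n) (λ q → binomℚ (suc n) (suc q) *ₗ x (suc q))
      ≈⟨ +ᴹ-congˡ (sumBelow-cong (suc n) pascal) ⟩
    x₀ +ᴹ sumBelow M (suc n) (λ q → binomℚ n q *ₗ x (suc q) +ᴹ upper (suc q))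
      ≈⟨ +ᴹ-congˡ (sumBelow-+ᴹ (suc n) _ _) ⟩
    x₀ +ᴹ (binomialSum (x ∘ suc) n +ᴹ sumBelow M (suc n) (upper ∘ suc))
      ≈⟨ x∙yz≈y∙xz x₀ _ _ ⟩
    binomialSum (x ∘ suc) n +ᴹ (upper 0 +ᴹ sumBelow M (suc n) (upper ∘ suc))
      ≈⟨ +ᴹ-congˡ (sumBelow-suc-head (suc n) upper) ⟨
    binomialSum (x ∘ suc) n +ᴹ (binomialSum x n +ᴹ upper (suc n))
      ≈⟨ +ᴹ-congˡ (+ᴹ-congˡ (≈ᴹ-trans (*ₗ-congʳ (≡.cong ℕ→ℚ (k>n⇒nCk≡0 (ℕ.n<1+n n)))) (*ₗ-zeroˡ _))) ⟩
    binomialSum (x ∘ suc) n +ᴹ (binomialSum x n +ᴹ 0ᴹ)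
      ≈⟨ +ᴹ-congˡ (+ᴹ-identityʳ _) ⟩
    binomialSum (x ∘ suc) n +ᴹ binomialSum x n
      ≈⟨ +ᴹ-comm _ _ ⟩
    binomialSum x n +ᴹ binomialSum (x ∘ suc) n ∎
    where
    x₀ = 1ℚ *ₗ x 0
    upper : ℕ → Carrierᴹ
    upper p = binomℚ n p *ₗ x p
    pascal : ∀ q → binomℚ (suc n) (suc q) *ₗ x (suc q) ≈ᴹ binomℚ n q *ₗ x (suc q) +ᴹ upper (suc q)
    pascal q = ≈ᴹ-trans
      (≈ᴹ-reflexive (≡.cong (λ k → ℕ→ℚ k *ₗ x (suc q)) (≡.sym (nCk+nC[k+1]≡[n+1]C[k+1] n q))))
      (≈ᴹ-trans (≈ᴹ-reflexive (≡.cong (_*ₗ x (suc q)) (ℕ→ℚ-+ (n C q) (n C suc q))))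
        (*ₗ-distribʳ (x (suc q)) _ _))

  binomialSum≈binomialTransform : ∀ x n → binomialSum x n ≈ᴹ binomialTransform x n
  binomialSum≈binomialTransform x zero    = ≈ᴹ-trans (+ᴹ-identityˡ _) (*ₗ-identityˡ (x 0))
  binomialSum≈binomialTransform x (suc n) = ≈ᴹ-trans (binomialSum-suc x n)
    (+ᴹ-cong (binomialSum≈binomialTransform x n) (binomialSum≈binomialTransform (x ∘ suc) n))

  binomialTransform-cong : ∀ {x y} → (∀ p → x p ≈ᴹ y p) → ∀ n → binomialTransform x n ≈ᴹ binomialTransform y n
  binomialTransform-cong x≈y zero    = x≈y 0
  binomialTransform-cong x≈y (suc n) =
    +ᴹ-cong (binomialTransform-cong x≈y n) (binomialTransform-cong (x≈y ∘ suc) n)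

  binomialTransform-+ᴹ : ∀ x y n →
    binomialTransform (λ p → x p +ᴹ y p) n ≈ᴹ binomialTransform x n +ᴹ binomialTransform y n
  binomialTransform-+ᴹ x y zero    = ≈ᴹ-refl
  binomialTransform-+ᴹ x y (suc n) = ≈ᴹ-trans
    (+ᴹ-cong (binomialTransform-+ᴹ x y n) (binomialTransform-+ᴹ (x ∘ suc) (y ∘ suc) n))
    (interchange _ _ _ _)

  binomialTransform-*ₗ : ∀ α x n → binomialTransform (λ p → α *ₗ x p) n ≈ᴹ α *ₗ binomialTransform x n
  binomialTransform-*ₗ α x zero    = ≈ᴹ-refl
  binomialTransform-*ₗ α x (suc n) = ≈ᴹ-trans
    (+ᴹ-cong (binomialTransform-*ₗ α x n) (binomialTransform-*ₗ α (x ∘ suc) n))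
    (≈ᴹ-sym (*ₗ-distribˡ α _ _))

  weighted : (ℕ → Carrierᴹ) → ℕ → Carrierᴹ
  weighted x p = ℕ→ℚ p *ₗ x p

  lagSum : (ℕ → Carrierᴹ) → ℕ → Carrierᴹ
  lagSum x p = x p +ᴹ x (pred p)

  binomialTransform-weighted : ∀ x n →
    binomialTransform (weighted x) (suc n) ≈ᴹ ℕ→ℚ (suc n) *ₗ binomialTransform (x ∘ suc) n
  binomialTransform-weighted x zero = ≈ᴹ-trans (+ᴹ-congʳ (*ₗ-zeroˡ (x 0))) (+ᴹ-identityˡ _)
  binomialTransform-weighted x (suc n) = begin
    B (weighted x) (suc n) +ᴹ B (weighted x ∘ suc) (suc n)
      ≈⟨ +ᴹ-cong (binomialTransform-weighted x n) shifted ⟩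
    N *ₗ B x′ n +ᴹ (N *ₗ B (x′ ∘ suc) n +ᴹ B x′ (suc n))
      ≈⟨ +ᴹ-assoc _ _ _ ⟨
    N *ₗ B x′ n +ᴹ N *ₗ B (x′ ∘ suc) n +ᴹ B x′ (suc n)
      ≈⟨ +ᴹ-congʳ (*ₗ-distribˡ N _ _) ⟨
    N *ₗ B x′ (suc n) +ᴹ B x′ (suc n)
      ≈⟨ +ᴹ-comm _ _ ⟩
    B x′ (suc n) +ᴹ N *ₗ B x′ (suc n)
      ≈⟨ ℕ→ℚ-suc-*ₗ (suc n) _ ⟨
    ℕ→ℚ (suc (suc n)) *ₗ B x′ (suc n) ∎
    where
    B = binomialTransform
    N = ℕ→ℚ (suc n)
    x′ = x ∘ suc
    shifted : B (weighted x ∘ suc) (suc n) ≈ᴹ N *ₗ B (x′ ∘ suc) n +ᴹ B x′ (suc n)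
    shifted = ≈ᴹ-trans (binomialTransform-cong (λ p → ℕ→ℚ-suc-*ₗ p (x′ p)) (suc n))
      (≈ᴹ-trans (binomialTransform-+ᴹ x′ (weighted x′) (suc n))
        (≈ᴹ-trans (+ᴹ-congˡ (binomialTransform-weighted x′ n)) (+ᴹ-comm _ _)))

  binomialTransform-weighted-lagSum : ∀ x n →
    binomialTransform (weighted (lagSum x)) n ≈ᴹ ℕ→ℚ n *ₗ binomialTransform x n
  binomialTransform-weighted-lagSum x zero =
    ≈ᴹ-trans (*ₗ-zeroˡ (x 0 +ᴹ x 0)) (≈ᴹ-sym (*ₗ-zeroˡ (x 0)))
  binomialTransform-weighted-lagSum x (suc n) = begin
    B (weighted (lagSum x)) (suc n)
      ≈⟨ binomialTransform-cong (λ p → *ₗ-distribˡ (ℕ→ℚ p) (x p) (x (pred p))) (suc n) ⟩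
    B (λ p → weighted x p +ᴹ weighted (x ∘ pred) p) (suc n)
      ≈⟨ binomialTransform-+ᴹ (weighted x) (weighted (x ∘ pred)) (suc n) ⟩
    B (weighted x) (suc n) +ᴹ B (weighted (x ∘ pred)) (suc n)
      ≈⟨ +ᴹ-cong (binomialTransform-weighted x n) (binomialTransform-weighted (x ∘ pred) n) ⟩
    N *ₗ B (x ∘ suc) n +ᴹ N *ₗ B x n
      ≈⟨ *ₗ-distribˡ N _ _ ⟨
    N *ₗ (B (x ∘ suc) n +ᴹ B x n)
      ≈⟨ *ₗ-congˡ (+ᴹ-comm _ _) ⟩
    N *ₗ B x (suc n) ∎
    where
    B = binomialTransform
    N = ℕ→ℚ (suc n)

  binomialTransform-alternating : ∀ z m →
    binomialTransform (λ p → sgn p *ₗ binomialTransform z p) m ≈ᴹ sgn m *ₗ z m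
  binomialTransform-alternating z zero    = ≈ᴹ-refl
  binomialTransform-alternating z (suc m) = begin
    B t m +ᴹ B (t ∘ suc) m
      ≈⟨ +ᴹ-cong (≈ᴹ-sym (*ₗ-identityˡ _)) shifted ⟩
    1ℚ *ₗ B t m +ᴹ (ℚ.- 1ℚ) *ₗ (B t m +ᴹ B t′ m)
      ≈⟨ *ₗ-neg-cancelˡ 1ℚ _ _ ⟩
    (ℚ.- 1ℚ) *ₗ B t′ m
      ≈⟨ *ₗ-congˡ (binomialTransform-alternating (z ∘ suc) m) ⟩
    (ℚ.- 1ℚ) *ₗ (sgn m *ₗ z (suc m))
      ≈⟨ *ₗ-assoc _ _ _ ⟨
    (ℚ.- 1ℚ ℚ.* sgn m) *ₗ z (suc m)
      ≡⟨ ≡.cong (_*ₗ z (suc m)) (-1*x≈-x (sgn m)) ⟩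
    sgn (suc m) *ₗ z (suc m) ∎
    where
    B = binomialTransform
    t t′ : ℕ → Carrierᴹ
    t p = sgn p *ₗ B z p
    t′ p = sgn p *ₗ B (z ∘ suc) p
    negate : ∀ p → t (suc p) ≈ᴹ (ℚ.- 1ℚ) *ₗ (t p +ᴹ t′ p)
    negate p = begin
      ℚ.- sgn p *ₗ w               ≡⟨ ≡.cong (_*ₗ w) (-1*x≈-x (sgn p)) ⟨
      (ℚ.- 1ℚ ℚ.* sgn p) *ₗ w      ≈⟨ *ₗ-assoc (ℚ.- 1ℚ) (sgn p) w ⟩
      (ℚ.- 1ℚ) *ₗ (sgn p *ₗ w)     ≈⟨ *ₗ-congˡ (*ₗ-distribˡ (sgn p) _ _) ⟩
      (ℚ.- 1ℚ) *ₗ (t p +ᴹ t′ p)    ∎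
      where w = B z p +ᴹ B (z ∘ suc) p
    shifted : B (t ∘ suc) m ≈ᴹ (ℚ.- 1ℚ) *ₗ (B t m +ᴹ B t′ m)
    shifted = ≈ᴹ-trans (binomialTransform-cong negate m)
      (≈ᴹ-trans (binomialTransform-*ₗ (ℚ.- 1ℚ) _ m) (*ₗ-congˡ (binomialTransform-+ᴹ t t′ m)))

  *ₗ-combine-three : ∀ {α β γ} H G L W → α ℚ.+ ℚ.- β ℚ.+ γ ≡ 1ℚ →
    α *ₗ G +ᴹ γ *ₗ L ≈ᴹ γ *ₗ H +ᴹ W →
    α *ₗ (H +ᴹ G) +ᴹ (ℚ.- β) *ₗ H +ᴹ γ *ₗ L ≈ᴹ H +ᴹ W
  *ₗ-combine-three {α} {β} {γ} H G L W α-β+γ≡1 eq = begin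
    α *ₗ (H +ᴹ G) +ᴹ (ℚ.- β) *ₗ H +ᴹ γ *ₗ L        ≈⟨ +ᴹ-congʳ (+ᴹ-congʳ (*ₗ-distribˡ α H G)) ⟩
    α *ₗ H +ᴹ α *ₗ G +ᴹ (ℚ.- β) *ₗ H +ᴹ γ *ₗ L     ≈⟨ +ᴹ-congʳ (xy∙z≈xz∙y _ _ _) ⟩
    α *ₗ H +ᴹ (ℚ.- β) *ₗ H +ᴹ α *ₗ G +ᴹ γ *ₗ L     ≈⟨ +ᴹ-assoc _ _ _ ⟩
    α *ₗ H +ᴹ (ℚ.- β) *ₗ H +ᴹ (α *ₗ G +ᴹ γ *ₗ L)   ≈⟨ +ᴹ-congˡ eq ⟩
    α *ₗ H +ᴹ (ℚ.- β) *ₗ H +ᴹ (γ *ₗ H +ᴹ W)        ≈⟨ +ᴹ-assoc _ _ _ ⟨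
    α *ₗ H +ᴹ (ℚ.- β) *ₗ H +ᴹ γ *ₗ H +ᴹ W          ≈⟨ +ᴹ-congʳ (+ᴹ-congʳ (*ₗ-distribʳ H α (ℚ.- β))) ⟨
    (α ℚ.+ ℚ.- β) *ₗ H +ᴹ γ *ₗ H +ᴹ W              ≈⟨ +ᴹ-congʳ (*ₗ-distribʳ H (α ℚ.+ ℚ.- β) γ) ⟨
    (α ℚ.+ ℚ.- β ℚ.+ γ) *ₗ H +ᴹ W                  ≡⟨ ≡.cong (λ δ → δ *ₗ H +ᴹ W) α-β+γ≡1 ⟩
    1ℚ *ₗ H +ᴹ W                                    ≈⟨ +ᴹ-congʳ (*ₗ-identityˡ H) ⟩
    H +ᴹ W                                          ∎

  doublyWeighted : (ℕ → Carrierᴹ) → ℕ → Carrierᴹ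
  doublyWeighted x = weighted (lagSum (weighted x))

  binomialTransform-doublyWeighted : ∀ x m →
    ℕ→ℚ (4 ℕ.* suc m ℕ.* suc m) *ₗ binomialTransform (x ∘ suc) m
      ≈ᴹ ℕ→ℚ 4 *ₗ binomialTransform (doublyWeighted x) (suc m)
  binomialTransform-doublyWeighted x m = begin
    ℕ→ℚ (4 ℕ.* suc m ℕ.* suc m) *ₗ B (x ∘ suc) m
      ≈⟨ ℕ→ℚ-*-*-*ₗ 4 (suc m) (suc m) _ ⟩
    ℕ→ℚ 4 *ₗ (N *ₗ (N *ₗ B (x ∘ suc) m))
      ≈⟨ *ₗ-congˡ (*ₗ-congˡ (binomialTransform-weighted x m)) ⟨
    ℕ→ℚ 4 *ₗ (N *ₗ B (weighted x) (suc m))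
      ≈⟨ *ₗ-congˡ (binomialTransform-weighted-lagSum (weighted x) (suc m)) ⟨
    ℕ→ℚ 4 *ₗ B (doublyWeighted x) (suc m) ∎
    where
    B = binomialTransform
    N = ℕ→ℚ (suc m)

  binomialTransform-doublyWeighted-pred : ∀ x m →
    ℕ→ℚ (4 ℕ.* m ℕ.* m) *ₗ binomialTransform x (pred m) +ᴹ ℕ→ℚ 4 *ₗ binomialTransform (doublyWeighted x) m
      ≈ᴹ ℕ→ℚ (4 ℕ.* m ℕ.* m) *ₗ binomialTransform x m
  binomialTransform-doublyWeighted-pred x zero = ≈ᴹ-trans
    (+ᴹ-congˡ (≈ᴹ-trans (*ₗ-congˡ (*ₗ-zeroˡ _)) (*ₗ-zeroʳ (ℕ→ℚ 4)))) (+ᴹ-identityʳ _)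
  binomialTransform-doublyWeighted-pred x (suc k) = ≈ᴹ-trans
    (+ᴹ-congˡ (≈ᴹ-sym (binomialTransform-doublyWeighted x k)))
    (≈ᴹ-sym (*ₗ-distribˡ (ℕ→ℚ (4 ℕ.* suc k ℕ.* suc k)) _ _))

  firstOrder : (ℕ → Carrierᴹ) → ℕ → Carrierᴹ
  firstOrder x p = ℕ→ℚ (4 ℕ.* suc p ℕ.* suc p) *ₗ x (suc p)
                 +ᴹ ℕ→ℚ ((2 ℕ.* p ℕ.+ 1) ℕ.* (2 ℕ.* p ℕ.+ 1)) *ₗ x p

  firstOrder-doublyWeighted : ∀ x p → x p +ᴹ ℕ→ℚ 4 *ₗ doublyWeighted x (suc p) ≈ᴹ firstOrder x p
  firstOrder-doublyWeighted x p = begin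
    x p +ᴹ ℕ→ℚ 4 *ₗ (N *ₗ (N *ₗ x (suc p) +ᴹ ℕ→ℚ p *ₗ x p))
      ≈⟨ +ᴹ-congˡ (≈ᴹ-trans (*ₗ-congˡ (*ₗ-distribˡ N _ _)) (*ₗ-distribˡ (ℕ→ℚ 4) _ _)) ⟩
    x p +ᴹ (ℕ→ℚ 4 *ₗ (N *ₗ (N *ₗ x (suc p))) +ᴹ ℕ→ℚ 4 *ₗ (N *ₗ (ℕ→ℚ p *ₗ x p)))
      ≈⟨ +ᴹ-congˡ (+ᴹ-cong (ℕ→ℚ-*-*-*ₗ 4 (suc p) (suc p) _) (ℕ→ℚ-*-*-*ₗ 4 (suc p) p _)) ⟨
    x p +ᴹ (ℕ→ℚ (4 ℕ.* suc p ℕ.* suc p) *ₗ x (suc p) +ᴹ ℕ→ℚ (4 ℕ.* suc p ℕ.* p) *ₗ x p)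
      ≈⟨ x∙yz≈y∙xz _ _ _ ⟩
    ℕ→ℚ (4 ℕ.* suc p ℕ.* suc p) *ₗ x (suc p) +ᴹ (x p +ᴹ ℕ→ℚ (4 ℕ.* suc p ℕ.* p) *ₗ x p)
      ≈⟨ +ᴹ-congˡ (ℕ→ℚ-suc-*ₗ (4 ℕ.* suc p ℕ.* p) (x p)) ⟨
    ℕ→ℚ (4 ℕ.* suc p ℕ.* suc p) *ₗ x (suc p) +ᴹ ℕ→ℚ (suc (4 ℕ.* suc p ℕ.* p)) *ₗ x p
      ≡⟨ ≡.cong (λ k → ℕ→ℚ (4 ℕ.* suc p ℕ.* suc p) *ₗ x (suc p) +ᴹ ℕ→ℚ k *ₗ x p) (odd² p) ⟨
    firstOrder x p ∎
    where
    N = ℕ→ℚ (suc p)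
    odd² : ∀ q → (2 ℕ.* q ℕ.+ 1) ℕ.* (2 ℕ.* q ℕ.+ 1) ≡ suc (4 ℕ.* suc q ℕ.* q)
    odd² = ℕ-Solver.solve-∀

  -- At m = 0 the last coefficient is 0, so the value of pred 0 does not matter.
  binomialTransform-recurrence : ∀ x m →
    ℕ→ℚ (4 ℕ.* suc m ℕ.* suc m) *ₗ binomialTransform x (suc m)
      +ᴹ (ℚ.- ℕ→ℚ (8 ℕ.* suc m ℕ.* suc m ℕ.∸ 8 ℕ.* suc m ℕ.+ 3)) *ₗ binomialTransform x m
      +ᴹ ℕ→ℚ (4 ℕ.* m ℕ.* m) *ₗ binomialTransform x (pred m)
    ≈ᴹ binomialTransform (firstOrder x) m
  binomialTransform-recurrence x m = begin
    _ ≈⟨ *ₗ-combine-three (B x m) (B (x ∘ suc) m) (B x (pred m)) W (recurrence-coefficients m) split ⟩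
    B x m +ᴹ W
      ≈⟨ +ᴹ-congˡ (binomialTransform-*ₗ (ℕ→ℚ 4) (doublyWeighted x ∘ suc) m) ⟨
    B x m +ᴹ B (λ p → ℕ→ℚ 4 *ₗ doublyWeighted x (suc p)) m
      ≈⟨ binomialTransform-+ᴹ x _ m ⟨
    B (λ p → x p +ᴹ ℕ→ℚ 4 *ₗ doublyWeighted x (suc p)) m
      ≈⟨ binomialTransform-cong (firstOrder-doublyWeighted x) m ⟩
    B (firstOrder x) m ∎
    where
    B = binomialTransform
    c₃ = ℕ→ℚ (4 ℕ.* m ℕ.* m)
    W = ℕ→ℚ 4 *ₗ B (doublyWeighted x ∘ suc) m
    split : ℕ→ℚ (4 ℕ.* suc m ℕ.* suc m) *ₗ B (x ∘ suc) m +ᴹ c₃ *ₗ B x (pred m) ≈ᴹ c₃ *ₗ B x m +ᴹ W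
    split = begin
      ℕ→ℚ (4 ℕ.* suc m ℕ.* suc m) *ₗ B (x ∘ suc) m +ᴹ c₃ *ₗ B x (pred m)
        ≈⟨ +ᴹ-congʳ (binomialTransform-doublyWeighted x m) ⟩
      ℕ→ℚ 4 *ₗ (B (doublyWeighted x) m +ᴹ B (doublyWeighted x ∘ suc) m) +ᴹ c₃ *ₗ B x (pred m)
        ≈⟨ +ᴹ-congʳ (*ₗ-distribˡ (ℕ→ℚ 4) _ _) ⟩
      ℕ→ℚ 4 *ₗ B (doublyWeighted x) m +ᴹ W +ᴹ c₃ *ₗ B x (pred m)
        ≈⟨ xy∙z≈zx∙y _ _ _ ⟩
      c₃ *ₗ B x (pred m) +ᴹ ℕ→ℚ 4 *ₗ B (doublyWeighted x) m +ᴹ W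
        ≈⟨ +ᴹ-congʳ (binomialTransform-doublyWeighted-pred x m) ⟩
      c₃ *ₗ B x m +ᴹ W ∎

  Jhat-terms : (ℕ → Carrierᴹ) → ℕ → Carrierᴹ
  Jhat-terms J p = (sgn p ℚ.* (genBinom -½ p ℚ.* genBinom -½ p)) *ₗ middleSum M J p

  Jhat≈binomialTransform : ∀ J n → Jhat M J n ≈ᴹ binomialTransform (Jhat-terms J) n
  Jhat≈binomialTransform J n = ≈ᴹ-trans
    (sumBelow-cong (suc n) (λ p → *ₗ-swap _ (binomℚ n p) (middleSum M J p)))
    (binomialSum≈binomialTransform (Jhat-terms J) n)

  innerSum≈binomialTransform : ∀ J i → innerSum M J i ≈ᴹ binomialTransform (λ j → sgn j *ₗ J (suc j)) i
  innerSum≈binomialTransform J i = ≈ᴹ-trans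
    (sumBelow-cong (suc i) (λ j → *ₗ-swap (sgn j) (binomℚ i j) (J (suc j))))
    (binomialSum≈binomialTransform (λ j → sgn j *ₗ J (suc j)) i)

  firstOrder-Jhat-terms : ∀ J p → firstOrder (Jhat-terms J) p ≈ᴹ sgn p *ₗ innerSum M J p
  firstOrder-Jhat-terms J p = begin
    c₁ *ₗ ((ℚ.- s ℚ.* A′) *ₗ (Mi +ᴹ γ *ₗ S)) +ᴹ Q *ₗ ((s ℚ.* A) *ₗ Mi)
      ≈⟨ +ᴹ-cong (*ₗ-assoc c₁ _ _) (*ₗ-assoc Q _ _) ⟨
    (c₁ ℚ.* (ℚ.- s ℚ.* A′)) *ₗ (Mi +ᴹ γ *ₗ S) +ᴹ (Q ℚ.* (s ℚ.* A)) *ₗ Mi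
      ≡⟨ ≡.cong₂ (λ α β → α *ₗ (Mi +ᴹ γ *ₗ S) +ᴹ β *ₗ Mi) falling-coefficient (swap Q s A) ⟩
    (ℚ.- κ) *ₗ (Mi +ᴹ γ *ₗ S) +ᴹ κ *ₗ Mi
      ≈⟨ +ᴹ-comm _ _ ⟩
    κ *ₗ Mi +ᴹ (ℚ.- κ) *ₗ (Mi +ᴹ γ *ₗ S)
      ≈⟨ *ₗ-neg-cancelˡ κ Mi (γ *ₗ S) ⟩
    (ℚ.- κ) *ₗ (γ *ₗ S)
      ≈⟨ *ₗ-assoc (ℚ.- κ) γ S ⟨
    (ℚ.- κ ℚ.* γ) *ₗ S
      ≡⟨ ≡.cong (_*ₗ S) sign-coefficient ⟩
    s *ₗ S ∎
    where
    s = sgn p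
    A = genBinom -½ p ℚ.* genBinom -½ p
    A′ = genBinom -½ (suc p) ℚ.* genBinom -½ (suc p)
    c₁ = ℕ→ℚ (4 ℕ.* suc p ℕ.* suc p)
    Q = ℕ→ℚ ((2 ℕ.* p ℕ.+ 1) ℕ.* (2 ℕ.* p ℕ.+ 1))
    γ = (ℚ.- 1ℚ) ℚ.* inv Q ℚ.* inv A
    Mi = middleSum M J p
    S = innerSum M J p
    κ = s ℚ.* (Q ℚ.* A)
    swap : ∀ q t a → q ℚ.* (t ℚ.* a) ≡ t ℚ.* (q ℚ.* a)
    swap = solve-∀ ℚ-ring
    falling-coefficient : c₁ ℚ.* (ℚ.- s ℚ.* A′) ≡ ℚ.- κ
    falling-coefficient = ≡.trans (negate c₁ s A′) (≡.cong (λ a → ℚ.- (s ℚ.* a)) (genBinom-½²-suc p))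
      where
      negate : ∀ c t a → c ℚ.* (ℚ.- t ℚ.* a) ≡ ℚ.- (t ℚ.* (c ℚ.* a))
      negate = solve-∀ ℚ-ring
    sign-coefficient : ℚ.- κ ℚ.* γ ≡ s
    sign-coefficient = ≡.trans (regroup s (Q ℚ.* A) γ)
      (≡.trans (≡.cong (λ k → ℚ.- (s ℚ.* k)) (middleSum-coefficient p)) (negate-neg s))
      where
      regroup : ∀ t k c → ℚ.- (t ℚ.* k) ℚ.* c ≡ ℚ.- (t ℚ.* (c ℚ.* k))
      regroup = solve-∀ ℚ-ring
      negate-neg : ∀ t → ℚ.- (t ℚ.* ℚ.- 1ℚ) ≡ t
      negate-neg = solve-∀ ℚ-ring

  binomialTransform-alternating-innerSum : ∀ J m →
    binomialTransform (λ p → sgn p *ₗ innerSum M J p) m ≈ᴹ J (suc m)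
  binomialTransform-alternating-innerSum J m = begin
    binomialTransform (λ p → sgn p *ₗ innerSum M J p) m
      ≈⟨ binomialTransform-cong (λ p → *ₗ-congˡ (innerSum≈binomialTransform J p)) m ⟩
    binomialTransform (λ p → sgn p *ₗ binomialTransform z p) m
      ≈⟨ binomialTransform-alternating z m ⟩
    sgn m *ₗ (sgn m *ₗ J (suc m))
      ≈⟨ *ₗ-assoc (sgn m) (sgn m) (J (suc m)) ⟨
    (sgn m ℚ.* sgn m) *ₗ J (suc m)
      ≡⟨ ≡.cong (_*ₗ J (suc m)) (sgn-square m) ⟩
    1ℚ *ₗ J (suc m)
      ≈⟨ *ₗ-identityˡ (J (suc m)) ⟩
    J (suc m) ∎
    where
    z : ℕ → Carrierᴹ
    z j = sgn j *ₗ J (suc j)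

  -- At m = 0 the index is -1, where JhatZ is 0ᴹ.
  JhatZ-pred : ∀ J m →
    ℕ→ℚ (4 ℕ.* m ℕ.* m) *ₗ JhatZ M J (+ suc m ℤ.- + 2)
      ≈ᴹ ℕ→ℚ (4 ℕ.* m ℕ.* m) *ₗ binomialTransform (Jhat-terms J) (pred m)
  JhatZ-pred J zero    = ≈ᴹ-trans (*ₗ-zeroˡ 0ᴹ) (≈ᴹ-sym (*ₗ-zeroˡ _))
  JhatZ-pred J (suc k) = *ₗ-congˡ (Jhat≈binomialTransform J k)

mainTheorem4 : {m ℓ : Level} (M : LeftModule +-*-ring m ℓ)
               (J : ℕ → LeftModule.Carrierᴹ M) (n : ℕ) → 1 ≤ n →
               LeftModule._≈ᴹ_ M
                 (LeftModule._+ᴹ_ M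
                   (LeftModule._+ᴹ_ M
                     (LeftModule._*ₗ_ M (ℕ→ℚ (4 ℕ.* n ℕ.* n)) (JhatZ M J (+ n)))
                     (LeftModule._*ₗ_ M (ℚ.- ℕ→ℚ (8 ℕ.* n ℕ.* n ℕ.∸ 8 ℕ.* n ℕ.+ 3))
                       (JhatZ M J (+ n ℤ.- + 1))))
                   (LeftModule._*ₗ_ M (ℕ→ℚ (4 ℕ.* (n ℕ.∸ 1) ℕ.* (n ℕ.∸ 1)))
                     (JhatZ M J (+ n ℤ.- + 2))))
                 (J n)
mainTheorem4 M J zero    ()
mainTheorem4 M J (suc m) _ = begin
  _ ≈⟨ +ᴹ-cong (+ᴹ-cong (*ₗ-congˡ (Jhat≈binomialTransform M J (suc m)))
                        (*ₗ-congˡ (Jhat≈binomialTransform M J m)))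
               (JhatZ-pred M J m) ⟩
  _ ≈⟨ binomialTransform-recurrence M (Jhat-terms M J) m ⟩
  binomialTransform M (firstOrder M (Jhat-terms M J)) m
    ≈⟨ binomialTransform-cong M (firstOrder-Jhat-terms M J) m ⟩
  binomialTransform M (λ p → sgn p *ₗ innerSum M J p) m
    ≈⟨ binomialTransform-alternating-innerSum M J m ⟩
  J (suc m) ∎
  where
  open LeftModule M
  open import Relation.Binary.Reasoning.Setoid ≈ᴹ-setoid
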